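{- Let $G$ be a finite abelian group of order $n$ (identity $e$) such that the generalized dihedral group $D(G)$ is non-abelian, and let $r\ge0$ satisfy $2^r=|\{g\in G:g^2=e\}|$. Let $\Gamma=\mathfrak{C}(D(G),D(G))$, $\Omega_1=\{(g,1):g^2=e\}$, $\Omega_2=\{(g,1):g\in G\}\setminus\Omega_1$, $\Omega_3=\{(g,-1):g\in G\}$. Then for a vertex $v$ of $\Gamma$, \[\deg(v)=\begin{cases}2n-1 & v\in\Omega_1,\\ n-1 & v\in\Omega_2,\\ 2^{r+1}-1 & v\in\Omega_3.\end{cases}\]
   Context: $D(G)=G\rtimes C_2$, $C_2=\{1,-1\}$, has elements $(g,c)$ with $g\in G$, $c\in C_2$, and multiplication $(g_1,c_1)(g_2,c_2)=(g_1g_2^{c_1},c_1c_2)$. The commuting graph $\mathfrak{C}(D(G),X)$ of $X\subseteq D(G)$ has vertex set $X$, distinct $u,v$ adjacent iff $uv=vu$. -}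

module Defs where

open import Data.Nat using (ℕ)
open import Data.Fin using (Fin)
open import Data.Fin.Properties using () renaming (_≟_ to _≟F_)
open import Data.List using (List; filter; length; map; concatMap; _∷_; [])
open import Data.List using () renaming (allFin to allFinL)
open import Data.Product using (_×_; _,_)
open import Data.Product.Properties using (≡-dec)
open import Relation.Nullary using (¬_; Dec; yes; no)
open import Relation.Nullary.Decidable using (_×-dec_; ¬?)
open import Relation.Binary.PropositionalEquality using (_≡_; _≢_; refl)
open import Algebra.Structures using (IsAbelianGroup)

-- A finite abelian group of order n, presented (up to isomorphism) on the
-- carrier Fin n with propositional equality.
record FiniteAbelianGroup (n : ℕ) : Set where
  field
    _∙_ : Fin n → Fin n → Fin n
    e : Fin n
    _⁻¹ : Fin n → Fin n
    isAbelianGroup : IsAbelianGroup _≡_ _∙_ e _⁻¹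

data C₂ : Set where
  pos neg : C₂   -- pos = 1, neg = -1

_·c_ : C₂ → C₂ → C₂
pos ·c c = c
neg ·c pos = neg
neg ·c neg = pos

_≟c_ : (a b : C₂) → Dec (a ≡ b)
pos ≟c pos = yes refl
pos ≟c neg = no (λ ())
neg ≟c pos = no (λ ())
neg ≟c neg = yes refl

allC₂ : List C₂
allC₂ = pos ∷ neg ∷ []

module Dihedral {n : ℕ} (G : FiniteAbelianGroup n) where
  open FiniteAbelianGroup G

  _^c_ : Fin n → C₂ → Fin n
  g ^c pos = g
  g ^c neg = g ⁻¹

  DG : Set
  DG = Fin n × C₂

  _⋆_ : DG → DG → DG
  (g₁ , c₁) ⋆ (g₂ , c₂) = (g₁ ∙ (g₂ ^c c₁)) , (c₁ ·c c₂)

  _≟D_ : (u v : DG) → Dec (u ≡ v)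
  _≟D_ = ≡-dec _≟F_ _≟c_

  elementsD : List DG
  elementsD = concatMap (λ g → map (λ c → (g , c)) allC₂) (allFinL n)

  IsAbelianD : Set
  IsAbelianD = (u v : DG) → u ⋆ v ≡ v ⋆ u

  degree : DG → ℕ
  degree v = length (filter (λ u → ¬? (u ≟D v) ×-dec ((u ⋆ v) ≟D (v ⋆ u))) elementsD)

  numInvolutionsOrId : ℕ
  numInvolutionsOrId = length (filter (λ g → (g ∙ g) ≟F e) (allFinL n))

module Submission where

-- Write elements of D(G) as rotations (h , pos) and reflections (h , neg).
-- Multiplying out, two elements commute exactly in the following cases:
--   * two rotations always commute (G is abelian);
--   * a rotation (g , pos) and a reflection commute iff g² = e;
--   * reflections (h , neg), (g , neg) commute iff (h g⁻¹)² = e.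
-- Hence the degree of a vertex is a sum of two counts over G, one over the
-- rotations and one over the reflections, of elements satisfying such a
-- condition (and differing from the vertex itself).  The counting of reflections
-- commuting with a reflection (g , neg) uses the translation h ↦ h g⁻¹, which
-- turns it into the count 2ʳ of solutions of x² = e.

open import Defs
open import Data.Nat using (ℕ; _*_; _∸_; _^_; _+_; zero; suc)
open import Data.Nat.Properties using (+-0-commutativeMonoid; +-commutativeSemigroup; +-assoc; +-comm; +-suc; +-identityʳ)
open import Data.Fin using (Fin) renaming (zero to fzero; suc to fsuc)
open import Data.Fin.Properties using (suc-injective) renaming (_≟_ to _≟F_)
open import Data.Fin.Permutation using (permutation)
open import Data.Bool using (true; false; if_then_else_)
open import Data.List using (List; _∷_; filter; length; concatMap; map; tabulate)
open import Data.Product using (_×_; _,_; proj₂)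
open import Data.Product.Properties using (,-injectiveˡ)
open import Data.Unit using (⊤; tt)
open import Level using (0ℓ)
open import Function using (_∘_; _⇔_; mk⇔; Equivalence)
open import Relation.Nullary using (¬_; Dec; yes; no; does)
open import Relation.Nullary.Decidable using (_×-dec_; ¬?)
open import Relation.Unary using (Pred; Decidable)
open import Relation.Binary.PropositionalEquality
  using (_≡_; _≢_; refl; sym; trans; cong; cong₂; module ≡-Reasoning)
open import Algebra.Bundles using (Group; AbelianGroup)
import Algebra.Properties.Group as GroupProperties
import Algebra.Properties.CommutativeSemigroup as CommutativeSemigroupProperties
import Algebra.Properties.CommutativeMonoid.Sum as NatSum
open NatSum +-0-commutativeMonoid using (sum; sum-cong-≗; ∑-distrib-+; sum-permute)

indicator : {P : Set} → Dec P → ℕ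
indicator d = if does d then 1 else 0

indicator-⇔ : {P Q : Set} → P ⇔ Q → (p : Dec P) (q : Dec Q) → indicator p ≡ indicator q
indicator-⇔ _ (yes _) (yes _) = refl
indicator-⇔ P⇔Q (yes p) (no ¬q) with () ← ¬q (Equivalence.to P⇔Q p)
indicator-⇔ P⇔Q (no ¬p) (yes q) with () ← ¬p (Equivalence.from P⇔Q q)
indicator-⇔ _ (no _) (no _) = refl

indicator-split : {P Q : Set} (p : Dec P) (q : Dec Q) →
  indicator p ≡ indicator (p ×-dec q) + indicator (p ×-dec ¬? q)
indicator-split (yes _) (yes _) = refl
indicator-split (yes _) (no _) = refl
indicator-split (no _) q = refl

count : {n : ℕ} {P : Pred (Fin n) 0ℓ} → Decidable P → ℕ
count P? = sum (λ i → indicator (P? i))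

module _ {n : ℕ} where

  count-⇔ : {P Q : Pred (Fin n) 0ℓ} (P? : Decidable P) (Q? : Decidable Q) →
    (∀ i → P i ⇔ Q i) → count P? ≡ count Q?
  count-⇔ P? Q? P⇔Q = sum-cong-≗ (λ i → indicator-⇔ (P⇔Q i) (P? i) (Q? i))

  count-all : {P : Pred (Fin n) 0ℓ} (P? : Decidable P) → (∀ i → P i) → count P? ≡ n
  count-all P? everywhere = trans (count-⇔ P? (λ _ → yes tt) (λ i → mk⇔ _ (λ _ → everywhere i))) (ones n)
    where
    ones : ∀ m → sum {m} (λ _ → 1) ≡ m
    ones zero = refl
    ones (suc m) = cong suc (ones m)

  count-none : {P : Pred (Fin n) 0ℓ} (P? : Decidable P) → (∀ i → ¬ P i) → count P? ≡ 0
  count-none P? none = trans (count-⇔ P? (λ _ → no (λ ())) (λ i → mk⇔ (none i) λ ())) (zeros n)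
    where
    zeros : ∀ m → sum {m} (λ _ → 0) ≡ 0
    zeros zero = refl
    zeros (suc m) = zeros m

  count-split : {P Q : Pred (Fin n) 0ℓ} (P? : Decidable P) (Q? : Decidable Q) →
    count P? ≡ count (λ i → P? i ×-dec Q? i) + count (λ i → P? i ×-dec ¬? (Q? i))
  count-split P? Q? = trans (sum-cong-≗ {n} (λ i → indicator-split (P? i) (Q? i)))
                            (∑-distrib-+ {n} _ _)

  count-permute : {P : Pred (Fin n) 0ℓ} (P? : Decidable P) (σ τ : Fin n → Fin n) →
    (∀ x → σ (τ x) ≡ x) → (∀ x → τ (σ x) ≡ x) → count (λ i → P? (σ i)) ≡ count P?
  count-permute P? σ τ στ τσ =
    sym (sum-permute (λ i → indicator (P? i)) (permutation σ τ στ τσ))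

count-≡ : {n : ℕ} (g : Fin n) → count (λ h → h ≟F g) ≡ 1
count-≡ {suc n} fzero =
  cong suc (count-none {n} (λ h → fsuc h ≟F fzero) (λ h ()))
count-≡ {suc n} (fsuc g) =
  trans (count-⇔ (λ h → fsuc h ≟F fsuc g) (λ h → h ≟F g)
                 (λ h → mk⇔ suc-injective (cong fsuc)))
        (count-≡ g)

count-remove : {n : ℕ} {P : Pred (Fin n) 0ℓ} (P? : Decidable P) (g : Fin n) → P g →
  count (λ h → P? h ×-dec ¬? (h ≟F g)) ≡ count P? ∸ 1
count-remove P? g Pg = sym (cong (_∸ 1) (begin
  count P?                                     ≡⟨ count-split P? (_≟F g) ⟩
  count (λ h → P? h ×-dec (h ≟F g)) + others   ≡⟨ cong (_+ others) only-g ⟩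
  1 + others                                   ∎))
  where
  open ≡-Reasoning
  others : ℕ
  others = count (λ h → P? h ×-dec ¬? (h ≟F g))
  -- since P g holds, "P h and h = g" just says h = g
  only-g : count (λ h → P? h ×-dec (h ≟F g)) ≡ 1
  only-g = trans (count-⇔ (λ h → P? h ×-dec (h ≟F g)) (_≟F g)
                          (λ h → mk⇔ proj₂ (λ { refl → Pg , refl })))
                 (count-≡ g)

count-≢ : {n : ℕ} (g : Fin n) → count (λ h → ¬? (h ≟F g)) ≡ n ∸ 1
count-≢ {n} g = begin
  count (λ h → ¬? (h ≟F g))               ≡⟨ count-⇔ (λ h → ¬? (h ≟F g)) (λ h → any? h ×-dec ¬? (h ≟F g))
                                               (λ h → mk⇔ (tt ,_) proj₂) ⟩
  count (λ h → any? h ×-dec ¬? (h ≟F g))  ≡⟨ count-remove any? g tt ⟩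
  count any? ∸ 1                          ≡⟨ cong (_∸ 1) (count-all any? (λ _ → tt)) ⟩
  n ∸ 1                                   ∎
  where
  open ≡-Reasoning
  any? : Decidable {A = Fin n} (λ _ → ⊤)
  any? _ = yes tt

module _ {A : Set} {P : Pred A 0ℓ} (P? : Decidable P) where

  length-filter-∷ : (x : A) (xs : List A) →
    length (filter P? (x ∷ xs)) ≡ indicator (P? x) + length (filter P? xs)
  length-filter-∷ x xs with does (P? x)
  ... | true = refl
  ... | false = refl

  length-filter-tabulate : {n : ℕ} (f : Fin n → A) →
    length (filter P? (tabulate f)) ≡ count (λ i → P? (f i))
  length-filter-tabulate {zero} f = refl
  length-filter-tabulate {suc n} f =
    trans (length-filter-∷ (f fzero) (tabulate (f ∘ fsuc)))
          (cong (indicator (P? (f fzero)) +_) (length-filter-tabulate (f ∘ fsuc)))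

-- The list of pairs (x , pos), (x , neg) for x in a list, in the order used
-- to enumerate D(G).
signed : {A : Set} → List A → List (A × C₂)
signed = concatMap (λ g → map (λ c → (g , c)) allC₂)

length-filter-signed : {A : Set} {P : Pred (A × C₂) 0ℓ} (P? : Decidable P) {n : ℕ} (f : Fin n → A) →
  length (filter P? (signed (tabulate f)))
    ≡ count (λ i → P? (f i , pos)) + count (λ i → P? (f i , neg))
length-filter-signed P? {zero} f = refl
length-filter-signed P? {suc n} f = begin
  length (filter P? ((f fzero , pos) ∷ (f fzero , neg) ∷ signed (tabulate (f ∘ fsuc))))
    ≡⟨ length-filter-∷ P? _ _ ⟩
  u + length (filter P? ((f fzero , neg) ∷ signed (tabulate (f ∘ fsuc))))
    ≡⟨ cong (u +_) (length-filter-∷ P? _ _) ⟩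
  u + (v + length (filter P? (signed (tabulate (f ∘ fsuc)))))
    ≡⟨ cong (λ m → u + (v + m)) (length-filter-signed P? (f ∘ fsuc)) ⟩
  u + (v + (U + V))                   ≡⟨ sym (+-assoc u v (U + V)) ⟩
  (u + v) + (U + V)                   ≡⟨ interchange u v U V ⟩
  (u + U) + (v + V)                   ∎
  where
  open ≡-Reasoning
  open CommutativeSemigroupProperties +-commutativeSemigroup using (interchange)
  u v U V : ℕ
  u = indicator (P? (f fzero , pos))
  v = indicator (P? (f fzero , neg))
  U = count (λ i → P? (f (fsuc i) , pos))
  V = count (λ i → P? (f (fsuc i) , neg))

-- m + (m - 1) = 2m - 1 in truncated subtraction (both sides are 0 for m = 0).
double-pred : ∀ m → m + (m ∸ 1) ≡ 2 * m ∸ 1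
double-pred zero = refl
double-pred (suc m) = trans (sym (+-suc m m)) (cong (λ k → m + suc k) (sym (+-identityʳ m)))

module _ {c ℓ} (H : Group c ℓ) where
  open Group H using (_≈_; _∙_; _⁻¹; ε; ∙-congˡ; inverseʳ) renaming (sym to ≈-sym; trans to ≈-trans)
  open GroupProperties H using (inverseʳ-unique)

  self-inverse⇔square-identity : ∀ x → (x ⁻¹ ≈ x) ⇔ (x ∙ x ≈ ε)
  self-inverse⇔square-identity x = mk⇔
    (λ x⁻¹≈x → ≈-trans (∙-congˡ (≈-sym x⁻¹≈x)) (inverseʳ x))
    (λ x²≈ε → ≈-sym (inverseʳ-unique x x x²≈ε))

module Degrees {n : ℕ} (G : FiniteAbelianGroup n) where
  open FiniteAbelianGroup G
  open Dihedral G

  abelianGroup : AbelianGroup 0ℓ 0ℓ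
  abelianGroup = record { isAbelianGroup = isAbelianGroup }

  open AbelianGroup abelianGroup using (comm; assoc; identityʳ; inverseʳ; inverseˡ; group)
  open GroupProperties group using (∙-cancelˡ; ⁻¹-involutive; ⁻¹-anti-homo-∙)

  square-identity? : Decidable (λ x → x ∙ x ≡ e)
  square-identity? x = (x ∙ x) ≟F e

  self-inverse : ∀ x → (x ⁻¹ ≡ x) ⇔ (x ∙ x ≡ e)
  self-inverse = self-inverse⇔square-identity group

  rotations-commute : ∀ h g → (h , pos) ⋆ (g , pos) ≡ (g , pos) ⋆ (h , pos)
  rotations-commute h g = cong (_, pos) (comm h g)

  -- (h , neg)(g , pos) = (h g⁻¹ , neg) and (g , pos)(h , neg) = (g h , neg)
  reflection-rotation-commute : ∀ h g →
    ((h , neg) ⋆ (g , pos) ≡ (g , pos) ⋆ (h , neg)) ⇔ (g ∙ g ≡ e)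
  reflection-rotation-commute h g = mk⇔
    (λ eq → Equivalence.to (self-inverse g)
              (∙-cancelˡ h (g ⁻¹) g (trans (,-injectiveˡ eq) (comm g h))))
    (λ g²≡e → cong (_, neg)
              (trans (cong (h ∙_) (Equivalence.from (self-inverse g) g²≡e)) (comm h g)))

  -- (h , pos)(g , neg) = (h g , neg) and (g , neg)(h , pos) = (g h⁻¹ , neg)
  rotation-reflection-commute : ∀ h g →
    ((h , pos) ⋆ (g , neg) ≡ (g , neg) ⋆ (h , pos)) ⇔ (h ∙ h ≡ e)
  rotation-reflection-commute h g = mk⇔
    (λ eq → Equivalence.to (self-inverse h)
              (sym (∙-cancelˡ g h (h ⁻¹) (trans (comm g h) (,-injectiveˡ eq)))))
    (λ h²≡e → cong (_, neg)
              (trans (comm h g) (cong (g ∙_) (sym (Equivalence.from (self-inverse h) h²≡e)))))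

  -- (h , neg)(g , neg) = (h g⁻¹ , pos) and (g , neg)(h , neg) = (g h⁻¹ , pos) = ((h g⁻¹)⁻¹ , pos)
  reflections-commute : ∀ h g →
    ((h , neg) ⋆ (g , neg) ≡ (g , neg) ⋆ (h , neg)) ⇔ ((h ∙ (g ⁻¹)) ∙ (h ∙ (g ⁻¹)) ≡ e)
  reflections-commute h g = mk⇔
    (λ eq → Equivalence.to (self-inverse (h ∙ (g ⁻¹))) (trans inverse-quotient (sym (,-injectiveˡ eq))))
    (λ s → cong (_, pos) (trans (sym (Equivalence.from (self-inverse (h ∙ (g ⁻¹))) s)) inverse-quotient))
    where
    inverse-quotient : (h ∙ (g ⁻¹)) ⁻¹ ≡ g ∙ (h ⁻¹)
    inverse-quotient = trans (⁻¹-anti-homo-∙ h (g ⁻¹)) (cong (_∙ (h ⁻¹)) (⁻¹-involutive g))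

  Adjacent : DG → DG → Set
  Adjacent v u = u ≢ v × u ⋆ v ≡ v ⋆ u

  adjacent? : (v : DG) → Decidable (Adjacent v)
  adjacent? v u = ¬? (u ≟D v) ×-dec ((u ⋆ v) ≟D (v ⋆ u))

  rotation-degree reflection-degree : DG → ℕ
  rotation-degree v = count (λ h → adjacent? v (h , pos))
  reflection-degree v = count (λ h → adjacent? v (h , neg))

  degree-split : ∀ v → degree v ≡ rotation-degree v + reflection-degree v
  degree-split v = length-filter-signed (adjacent? v) (λ h → h)

  involutions-count : numInvolutionsOrId ≡ count square-identity?
  involutions-count = length-filter-tabulate square-identity? (λ h → h)

  rotation-neighbours-of-rotation : ∀ g h → Adjacent (g , pos) (h , pos) ⇔ (h ≢ g)
  rotation-neighbours-of-rotation g h = mk⇔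
    (λ (≢ , _) h≡g → ≢ (cong (_, pos) h≡g))
    (λ h≢g → (λ eq → h≢g (,-injectiveˡ eq)) , rotations-commute h g)

  reflection-neighbours-of-rotation : ∀ g h → Adjacent (g , pos) (h , neg) ⇔ (g ∙ g ≡ e)
  reflection-neighbours-of-rotation g h = mk⇔
    (λ (_ , commutes) → Equivalence.to (reflection-rotation-commute h g) commutes)
    (λ g²≡e → (λ ()) , Equivalence.from (reflection-rotation-commute h g) g²≡e)

  rotation-neighbours-of-reflection : ∀ g h → Adjacent (g , neg) (h , pos) ⇔ (h ∙ h ≡ e)
  rotation-neighbours-of-reflection g h = mk⇔
    (λ (_ , commutes) → Equivalence.to (rotation-reflection-commute h g) commutes)
    (λ h²≡e → (λ ()) , Equivalence.from (rotation-reflection-commute h g) h²≡e)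

  reflection-neighbours-of-reflection : ∀ g h →
    Adjacent (g , neg) (h , neg) ⇔ ((h ∙ (g ⁻¹)) ∙ (h ∙ (g ⁻¹)) ≡ e × h ≢ g)
  reflection-neighbours-of-reflection g h = mk⇔
    (λ (≢ , commutes) → Equivalence.to (reflections-commute h g) commutes
                      , (λ h≡g → ≢ (cong (_, neg) h≡g)))
    (λ (s , h≢g) → (λ eq → h≢g (,-injectiveˡ eq)) , Equivalence.from (reflections-commute h g) s)

  rotation-degree-of-rotation : ∀ g → rotation-degree (g , pos) ≡ n ∸ 1
  rotation-degree-of-rotation g =
    trans (count-⇔ (λ h → adjacent? (g , pos) (h , pos)) (λ h → ¬? (h ≟F g))
                   (rotation-neighbours-of-rotation g))
          (count-≢ g)

  degree-involutive-rotation : ∀ g → g ∙ g ≡ e → degree (g , pos) ≡ 2 * n ∸ 1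
  degree-involutive-rotation g g²≡e = begin
    degree (g , pos)     ≡⟨ degree-split (g , pos) ⟩
    rotation-degree (g , pos) + reflection-degree (g , pos)
                         ≡⟨ cong₂ _+_ (rotation-degree-of-rotation g) all-reflections ⟩
    (n ∸ 1) + n          ≡⟨ +-comm (n ∸ 1) n ⟩
    n + (n ∸ 1)          ≡⟨ double-pred n ⟩
    2 * n ∸ 1            ∎
    where
    open ≡-Reasoning
    all-reflections : reflection-degree (g , pos) ≡ n
    all-reflections = count-all (λ h → adjacent? (g , pos) (h , neg))
      (λ h → Equivalence.from (reflection-neighbours-of-rotation g h) g²≡e)

  degree-other-rotation : ∀ g → g ∙ g ≢ e → degree (g , pos) ≡ n ∸ 1
  degree-other-rotation g g²≢e = begin
    degree (g , pos)     ≡⟨ degree-split (g , pos) ⟩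
    rotation-degree (g , pos) + reflection-degree (g , pos)
                         ≡⟨ cong₂ _+_ (rotation-degree-of-rotation g) no-reflections ⟩
    (n ∸ 1) + 0          ≡⟨ +-identityʳ (n ∸ 1) ⟩
    n ∸ 1                ∎
    where
    open ≡-Reasoning
    no-reflections : reflection-degree (g , pos) ≡ 0
    no-reflections = count-none (λ h → adjacent? (g , pos) (h , neg))
      (λ h adj → g²≢e (Equivalence.to (reflection-neighbours-of-rotation g h) adj))

  degree-reflection : ∀ g → degree (g , neg) ≡ 2 * numInvolutionsOrId ∸ 1
  degree-reflection g = begin
    degree (g , neg)     ≡⟨ degree-split (g , neg) ⟩
    rotation-degree (g , neg) + reflection-degree (g , neg)
                         ≡⟨ cong₂ _+_ rotations reflections ⟩
    N + (N ∸ 1)          ≡⟨ double-pred N ⟩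
    2 * N ∸ 1            ∎
    where
    open ≡-Reasoning
    N : ℕ
    N = numInvolutionsOrId

    translate : Fin n → Fin n
    translate h = h ∙ (g ⁻¹)

    untranslate : Fin n → Fin n
    untranslate h = h ∙ g

    translate-untranslate : ∀ h → translate (untranslate h) ≡ h
    translate-untranslate h = trans (assoc h g (g ⁻¹)) (trans (cong (h ∙_) (inverseʳ g)) (identityʳ h))

    untranslate-translate : ∀ h → untranslate (translate h) ≡ h
    untranslate-translate h = trans (assoc h (g ⁻¹) g) (trans (cong (h ∙_) (inverseˡ g)) (identityʳ h))

    translate-g : translate g ∙ translate g ≡ e
    translate-g = trans (cong (λ x → x ∙ x) (inverseʳ g)) (identityʳ e)

    rotations : rotation-degree (g , neg) ≡ N
    rotations = trans (count-⇔ (λ h → adjacent? (g , neg) (h , pos)) square-identity?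
                               (rotation-neighbours-of-reflection g))
                      (sym involutions-count)

    reflections : reflection-degree (g , neg) ≡ N ∸ 1
    reflections = begin
      reflection-degree (g , neg)
        ≡⟨ count-⇔ (λ h → adjacent? (g , neg) (h , neg))
                   (λ h → square-identity? (translate h) ×-dec ¬? (h ≟F g))
                   (reflection-neighbours-of-reflection g) ⟩
      count (λ h → square-identity? (translate h) ×-dec ¬? (h ≟F g))
        ≡⟨ count-remove (λ h → square-identity? (translate h)) g translate-g ⟩
      count (λ h → square-identity? (translate h)) ∸ 1
        ≡⟨ cong (_∸ 1) (count-permute square-identity? translate untranslate
                                      translate-untranslate untranslate-translate) ⟩
      count square-identity? ∸ 1
        ≡⟨ cong (_∸ 1) (sym involutions-count) ⟩
      N ∸ 1 ∎

corollary2p3 : (n : ℕ) (G : FiniteAbelianGroup n) →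
    let open FiniteAbelianGroup G in
    let open Dihedral G in
    ¬ IsAbelianD → (r : ℕ) → 2 ^ r ≡ numInvolutionsOrId →
    ((g : Fin n) → g ∙ g ≡ e → degree (g , pos) ≡ 2 * n ∸ 1)
    × ((g : Fin n) → g ∙ g ≢ e → degree (g , pos) ≡ n ∸ 1)
    × ((g : Fin n) → degree (g , neg) ≡ 2 ^ (r + 1) ∸ 1)
corollary2p3 n G _ r 2^r≡N =
  degree-involutive-rotation , degree-other-rotation , degree-of-reflection
  where
  open Degrees G
  open Dihedral G using (degree)
  -- 2^(r+1) - 1 = 2·2^r - 1 = 2N - 1
  degree-of-reflection : ∀ g → degree (g , neg) ≡ 2 ^ (r + 1) ∸ 1
  degree-of-reflection g =
    trans (degree-reflection g)
          (cong (_∸ 1) (trans (cong (2 *_) (sym 2^r≡N)) (cong (2 ^_) (+-comm 1 r))))
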